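{- Let $\Gamma$ be a finite connected bipartite graph and let $G\le\mathrm{Aut}(\Gamma)$ act regularly on the edges of $\Gamma$. Let $H\le\mathrm{Aut}(\Gamma)$ be such that $G\le H$, the orbits of $H$ on the vertex set of $\Gamma$ are exactly the two biparts, and for every vertex $v$ of $\Gamma$, either $G_v^{\Gamma(v)}=H_v^{\Gamma(v)}$ or $(G_v^{\Gamma(v)},H_v^{\Gamma(v)})$ is a complete colour pair. Then $H$, acting naturally on the edges of $\Gamma$, is a colour-preserving group of automorphisms of the line graph $\mathcal{L}(\Gamma)$ viewed as a Cayley graph on $G$ (fixing an edge $e$ and identifying the vertex $e^g$ of $\mathcal{L}(\Gamma)$ with $g\in G$).
   Context: All groups and graphs are finite. For a group $G$ and inverse-closed $S\subseteq G$, $\mathrm{Cay}(G,S)$ is the edge-coloured graph on $G$ with edges $\{g,sg\}$ ($g\in G,s\in S$) coloured $\{s,s^{ -1}\}$; colour-preserving automorphisms map each edge to an edge of the same colour, and $\mathrm{Aut}_c$ is the group of them. $\Gamma(v)$ is the neighbourhood of $v$, and for $X\le\mathrm{Aut}(\Gamma)$, $X_v^{\Gamma(v)}$ is the permutation group induced by the stabiliser $X_v$ on $\Gamma(v)$. $\mathrm{K}_G=\mathrm{Cay}(G,G\setminus\{1\})$. A generalised dihedral group is not needed; a generalised dicyclic group over an abelian group $A$ of even order and exponent greater than $2$ with an involution $y\in A$ is $\langle A,x\mid x^2=y,\ x^{ -1}ax=a^{ -1}\ \forall a\in A\rangle$. A pair $(G,B)$, where $B$ is a permutation group on a set $\Delta$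 and $G$ is a regular subgroup of $B$, is a complete colour pair if (a) $G$ is either an abelian group that is not an elementary abelian $2$-group, or a generalised dicyclic group, and (b) under some bijection $\Delta\to G$ carrying the action of $G$ to $G_R$, $B$ is carried into $\mathrm{Aut}_c(\mathrm{K}_G)$. (These groups $G$ are exactly those with $G_R<\mathrm{Aut}_c(\mathrm{K}_G)$; they include $\mathrm{Q}_8\times\mathbb{Z}_2^n$.) -}

module Defs where

open import Data.Nat using (ℕ)
open import Data.Fin using (Fin)
open import Data.Bool using (Bool; true; false)
open import Data.Fin.Permutation using (Permutation′; _⟨$⟩ʳ_; _∘ₚ_; flip; id)
open import Data.Product using (Σ; ∃; _×_; _,_; proj₁; proj₂)
open import Data.Sum using (_⊎_)
open import Relation.Binary.PropositionalEquality using (_≡_)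
open import Relation.Nullary using (¬_)

record Graph (n : ℕ) : Set where
  field
    adj    : Fin n → Fin n → Bool
    sym    : ∀ u w → adj u w ≡ adj w u
    irrefl : ∀ u → adj u u ≡ false

module _ {n : ℕ} (Γ : Graph n) where

  Adj : Fin n → Fin n → Set
  Adj u w = Graph.adj Γ u w ≡ true

  data Walk : Fin n → Fin n → Set where
    here : ∀ {u} → Walk u u
    step : ∀ {u w z} → Adj u w → Walk w z → Walk u z

  Connected : Set
  Connected = ∀ u w → Walk u w

  IsBipartition : (Fin n → Bool) → Set
  IsBipartition c = ∀ u w → Adj u w → ¬ (c u ≡ c w)

-- Products follow the paper's
-- right-action convention: π · σ means "first π, then σ"
-- (this is exactly stdlib's _∘ₚ_).

Perm : ℕ → Set
Perm n = Permutation′ n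

infixl 7 _·_
_·_ : ∀ {n} → Perm n → Perm n → Perm n
π · σ = π ∘ₚ σ

_⁻¹ : ∀ {n} → Perm n → Perm n
π ⁻¹ = flip π

infix 4 _≗ₚ_
_≗ₚ_ : ∀ {n} → Perm n → Perm n → Set
π ≗ₚ σ = ∀ i → π ⟨$⟩ʳ i ≡ σ ⟨$⟩ʳ i

record PermGroup (n : ℕ) : Set₁ where
  field
    _∋_   : Perm n → Set
    resp  : ∀ {π σ} → π ≗ₚ σ → _∋_ π → _∋_ σ
    id∈   : _∋_ id
    ·∈    : ∀ {π σ} → _∋_ π → _∋_ σ → _∋_ (π · σ)
    ⁻¹∈   : ∀ {π} → _∋_ π → _∋_ (π ⁻¹)

open PermGroup public using (_∋_)

_≤G_ : ∀ {n} → PermGroup n → PermGroup n → Set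
G ≤G H = ∀ π → G ∋ π → H ∋ π

IsAutGroup : ∀ {n} → Graph n → PermGroup n → Set
IsAutGroup {n} Γ X = ∀ π → X ∋ π → ∀ u w →
  Graph.adj Γ (π ⟨$⟩ʳ u) (π ⟨$⟩ʳ w) ≡ Graph.adj Γ u w

-- Edges.  An edge {u,w} is represented by an ordered adjacent pair,
-- two representatives being identified up to swapping.

VPair : ℕ → Set
VPair n = Fin n × Fin n

Edge : ∀ {n} → Graph n → Set
Edge {n} Γ = Σ (VPair n) (λ p → Adj Γ (proj₁ p) (proj₂ p))

infix 4 _≈E_
_≈E_ : ∀ {n} → VPair n → VPair n → Set
(u , w) ≈E (u' , w') = (u ≡ u' × w ≡ w') ⊎ (u ≡ w' × w ≡ u')

act : ∀ {n} → Perm n → VPair n → VPair n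
act π (u , w) = (π ⟨$⟩ʳ u , π ⟨$⟩ʳ w)

LAdj : ∀ {n} → VPair n → VPair n → Set
LAdj (u , w) (u' , w') =
  ¬ ((u , w) ≈E (u' , w')) ×
  ((u ≡ u' ⊎ u ≡ w') ⊎ (w ≡ u' ⊎ w ≡ w'))

EdgeRegular : ∀ {n} → (Γ : Graph n) → PermGroup n → Set
EdgeRegular Γ G = ∀ (e f : Edge Γ) →
  (∃ λ g → G ∋ g × act g (proj₁ e) ≈E proj₁ f) ×
  (∀ g g' → G ∋ g → G ∋ g' →
     act g (proj₁ e) ≈E proj₁ f → act g' (proj₁ e) ≈E proj₁ f → g ≗ₚ g')

OrbitsAre : ∀ {n} → PermGroup n → (Fin n → Bool) → Set
OrbitsAre H c = ∀ u w →
  ((∃ λ h → H ∋ h × h ⟨$⟩ʳ u ≡ w) → c u ≡ c w) ×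
  (c u ≡ c w → ∃ λ h → H ∋ h × h ⟨$⟩ʳ u ≡ w)

-- Local actions.  X_v^{Γ(v)} consists of the permutations of
-- Γ(v) = {x | Adj v x} induced by the stabiliser X_v; two elements of
-- X_v induce the same element iff they agree on Γ(v).

module Local {n : ℕ} (Γ : Graph n) (v : Fin n) where

  Stab : PermGroup n → Perm n → Set
  Stab X g = X ∋ g × g ⟨$⟩ʳ v ≡ v

  infix 4 _≈ₗ_
  _≈ₗ_ : Perm n → Perm n → Set
  g ≈ₗ g' = ∀ x → Adj Γ v x → g ⟨$⟩ʳ x ≡ g' ⟨$⟩ʳ x

  SameLocal : PermGroup n → PermGroup n → Set
  SameLocal G H =
    (∀ h → Stab H h → ∃ λ g → Stab G g × g ≈ₗ h) ×
    (∀ g → Stab G g → ∃ λ h → Stab H h × h ≈ₗ g)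

  AbelianNotElem2 : PermGroup n → Set
  AbelianNotElem2 G =
    (∀ a b → Stab G a → Stab G b → a · b ≈ₗ b · a) ×
    (∃ λ a → Stab G a × ¬ (a · a ≈ₗ id))

  -- A = G_v^{Γ(v)} is a generalised dicyclic group
  -- ⟨ A' , x | x² = y , x⁻¹ a x = a⁻¹ (a ∈ A') ⟩, i.e. A has an abelian
  -- subgroup A' of index 2 and exponent > 2 containing an involution y,
  -- and an element x ∉ A' with x² = y inverting A' by conjugation.
  GenDicyclic : PermGroup n → Set₁
  GenDicyclic G = Σ (Perm n → Set) λ P → ∃ λ x → ∃ λ y →
    (∀ a → P a → Stab G a) ×
    (∀ a b → a ≈ₗ b → P a → P b) ×
    P id ×
    (∀ a b → P a → P b → P (a · b)) ×
    (∀ a → P a → P (a ⁻¹)) ×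
    (∀ a b → P a → P b → a · b ≈ₗ b · a) ×
    (∃ λ a → P a × ¬ (a · a ≈ₗ id)) ×
    P y × (y · y ≈ₗ id) × ¬ (y ≈ₗ id) ×
    Stab G x × ¬ P x × (x · x ≈ₗ y) ×
    (∀ a → P a → x ⁻¹ · a · x ≈ₗ a ⁻¹) ×
    (∀ g → Stab G g → P g ⊎ (∃ λ a → P a × g ≈ₗ a · x))

  CompleteColourPair : PermGroup n → PermGroup n → Set₁
  CompleteColourPair G H =
    (∀ g → Stab G g → Stab H g) ×
    (∀ x y → Adj Γ v x → Adj Γ v y → ∃ λ g → Stab G g × g ⟨$⟩ʳ x ≡ y) ×
    (∀ g x → Stab G g → Adj Γ v x → g ⟨$⟩ʳ x ≡ x → g ≈ₗ id) ×
    (AbelianNotElem2 G ⊎ GenDicyclic G) ×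
    -- (b) a bijection φ : Γ(v) → G_v^{Γ(v)} carrying the action of
    -- G_v^{Γ(v)} to the right regular action, and carrying
    -- H_v^{Γ(v)} into Aut_c(K_{G_v^{Γ(v)}})
    (Σ (Fin n → Perm n) λ φ →
      (∀ x → Adj Γ v x → Stab G (φ x)) ×
      (∀ x y → Adj Γ v x → Adj Γ v y → φ x ≈ₗ φ y → x ≡ y) ×
      (∀ a → Stab G a → ∃ λ x → Adj Γ v x × φ x ≈ₗ a) ×
      (∀ a x → Stab G a → Adj Γ v x → φ (a ⟨$⟩ʳ x) ≈ₗ φ x · a) ×
      (∀ b x y → Stab H b → Adj Γ v x → Adj Γ v y →
         let p  = φ x ; q  = φ y
             p' = φ (b ⟨$⟩ʳ x) ; q' = φ (b ⟨$⟩ʳ y)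
         in (q' · p' ⁻¹ ≈ₗ q · p ⁻¹) ⊎ (q' · p' ⁻¹ ≈ₗ p · q ⁻¹)))

-- Conclusion: with a fixed edge e and e^g identified with g ∈ G, L(Γ) is
-- Cay(G,S); h ∈ H acts on it (g ↦ g' where e^{g'} = (e^g)^h) as a
-- colour-preserving automorphism: Cayley edges {a,b} (colour
-- {b a⁻¹, a b⁻¹}) go to Cayley edges of the same colour.

ColourPreservingOnLineGraph : ∀ {n} → (Γ : Graph n) → PermGroup n →
  PermGroup n → Edge Γ → Set
ColourPreservingOnLineGraph Γ G H (e , _) =
  ∀ h a b a' b' → H ∋ h → G ∋ a → G ∋ b → G ∋ a' → G ∋ b' →
  LAdj (act a e) (act b e) →
  act a' e ≈E act h (act a e) →
  act b' e ≈E act h (act b e) →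
  LAdj (act a' e) (act b' e) ×
  ((b' · a' ⁻¹ ≗ₚ b · a ⁻¹) ⊎ (b' · a' ⁻¹ ≗ₚ a · b ⁻¹))

module Submission where

open import Defs
open import Data.Nat using (ℕ)
open import Data.Fin using (Fin)
open import Data.Fin.Permutation using (_⟨$⟩ʳ_; inverseʳ; id)
open import Data.Bool using (Bool; true)
open import Data.Empty using (⊥-elim)
open import Data.Sum using (_⊎_; inj₁; inj₂)
import Data.Sum as Sum
open import Data.Product using (_,_; proj₁; proj₂; swap)
open import Function using (_∘_)
open import Function.Bundles using (Inverse; Injection)
open import Function.Properties.Inverse using (Inverse⇒Injection)
open import Relation.Nullary using (¬_)
open import Relation.Binary.PropositionalEquality
open ≡-Reasoning

-- As H preserves the biparts and G ≤ H, an
-- element h ∈ H carries e^a onto e^{a'} endpoint by endpoint, so adjacency in L(Γ) is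
-- preserved because h is injective.  If e^a and e^b meet in a p = b p, with p, q the
-- ends of e, then s = b a⁻¹ and s' = b' a'⁻¹ lie in G_p, and k = a h a'⁻¹ ∈ H_p fixes q
-- and sends q^s to q^{s'}.  By edge-regularity an element of G_p is determined by its
-- image of q, so it suffices that k sends q^s to q^s or q^{s⁻¹}.  If the local actions
-- agree, k agrees on Γ(p) with an element of G_p fixing q, i.e. with the identity; for a
-- complete colour pair, φ turns k into a colour-preserving automorphism of K_{G_p}
-- fixing f = φ(q), and such an automorphism sends f s to f s or f s⁻¹.

private
  variable
    n : ℕ

⟨$⟩ʳ-injective : (π : Perm n) {i j : Fin n} → π ⟨$⟩ʳ i ≡ π ⟨$⟩ʳ j → i ≡ j
⟨$⟩ʳ-injective π = Injection.injective (Inverse⇒Injection π)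

fixes-·⁻¹ : (π σ : Perm n) {x : Fin n} → σ ⟨$⟩ʳ x ≡ π ⟨$⟩ʳ x → (σ · π ⁻¹) ⟨$⟩ʳ x ≡ x
fixes-·⁻¹ π σ σx≡πx = Inverse.inverseʳ π σx≡πx

·⁻¹∈ : (X : PermGroup n) {π σ : Perm n} → X ∋ σ → X ∋ π → X ∋ (σ · π ⁻¹)
·⁻¹∈ X σ∈ π∈ = PermGroup.·∈ X σ∈ (PermGroup.⁻¹∈ X π∈)

act-preserves-LAdj : (π : Perm n) {x y : VPair n} → LAdj x y → LAdj (act π x) (act π y)
act-preserves-LAdj π {u , w} {u' , w'} (x≉y , meet) = x≉y ∘ reflect , Sum.map share share meet
  where
  share : ∀ {i j k} → i ≡ j ⊎ i ≡ k → π ⟨$⟩ʳ i ≡ π ⟨$⟩ʳ j ⊎ π ⟨$⟩ʳ i ≡ π ⟨$⟩ʳ k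
  share = Sum.map (cong (π ⟨$⟩ʳ_)) (cong (π ⟨$⟩ʳ_))
  reflect : act π (u , w) ≈E act π (u' , w') → (u , w) ≈E (u' , w')
  reflect (inj₁ (eu , ew)) = inj₁ (⟨$⟩ʳ-injective π eu , ⟨$⟩ʳ-injective π ew)
  reflect (inj₂ (eu , ew)) = inj₂ (⟨$⟩ʳ-injective π eu , ⟨$⟩ʳ-injective π ew)

module _ {n : ℕ} (c : Fin n → Bool) where

  PreservesColouring : Perm n → Set
  PreservesColouring π = ∀ x → c (π ⟨$⟩ʳ x) ≡ c x

  orbitsAre⇒preservesColouring : (H : PermGroup n) → OrbitsAre H c →
    ∀ {h} → H ∋ h → PreservesColouring h
  orbitsAre⇒preservesColouring H orbits {h} h∈ x = sym (proj₁ (orbits x (h ⟨$⟩ʳ x)) (h , h∈ , refl))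

  preservesColouring-separates : ∀ {π σ x y} → PreservesColouring π → PreservesColouring σ →
    ¬ c x ≡ c y → ¬ π ⟨$⟩ʳ x ≡ σ ⟨$⟩ʳ y
  preservesColouring-separates {π} {σ} {x} {y} π-pres σ-pres cx≢cy πx≡σy =
    cx≢cy (begin
      c x            ≡⟨ sym (π-pres x) ⟩
      c (π ⟨$⟩ʳ x)   ≡⟨ cong c πx≡σy ⟩
      c (σ ⟨$⟩ʳ y)   ≡⟨ σ-pres y ⟩
      c y            ∎)

  module _ {u w : Fin n} (cu≢cw : ¬ c u ≡ c w) (π σ : Perm n)
           (π-pres : PreservesColouring π) (σ-pres : PreservesColouring σ) where

    u≁w : ¬ π ⟨$⟩ʳ u ≡ σ ⟨$⟩ʳ w
    u≁w = preservesColouring-separates {π} {σ} {u} {w} π-pres σ-pres cu≢cw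

    w≁u : ¬ π ⟨$⟩ʳ w ≡ σ ⟨$⟩ʳ u
    w≁u = preservesColouring-separates {π} {σ} {w} {u} π-pres σ-pres (cu≢cw ∘ sym)

    ≈E⇒≡ : act π (u , w) ≈E act σ (u , w) → act π (u , w) ≡ act σ (u , w)
    ≈E⇒≡ (inj₁ (eu , ew))  = cong₂ _,_ eu ew
    ≈E⇒≡ (inj₂ (euw , _)) = ⊥-elim (u≁w euw)

    LAdj⇒shared-endpoint : LAdj (act π (u , w)) (act σ (u , w)) →
      π ⟨$⟩ʳ u ≡ σ ⟨$⟩ʳ u ⊎ π ⟨$⟩ʳ w ≡ σ ⟨$⟩ʳ w
    LAdj⇒shared-endpoint (_ , inj₁ (inj₁ eu)) = inj₁ eu
    LAdj⇒shared-endpoint (_ , inj₂ (inj₂ ew)) = inj₂ ew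
    LAdj⇒shared-endpoint (_ , inj₁ (inj₂ euw)) = ⊥-elim (u≁w euw)
    LAdj⇒shared-endpoint (_ , inj₂ (inj₁ ewu)) = ⊥-elim (w≁u ewu)

module _ {n : ℕ} (Γ : Graph n) (v : Fin n) (X : PermGroup n) where
  open Local Γ v

  Stab-⁻¹ : ∀ g → Stab X g → Stab X (g ⁻¹)
  Stab-⁻¹ g (g∈ , gv) = PermGroup.⁻¹∈ X g∈ , Inverse.inverseʳ g (sym gv)

  Stab-adj : IsAutGroup Γ X → ∀ g {x} → Stab X g → Adj Γ v x → Adj Γ v (g ⟨$⟩ʳ x)
  Stab-adj autX g {x} (g∈ , gv) vx = begin
    Graph.adj Γ v (g ⟨$⟩ʳ x)            ≡⟨ cong (λ z → Graph.adj Γ z (g ⟨$⟩ʳ x)) (sym gv) ⟩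
    Graph.adj Γ (g ⟨$⟩ʳ v) (g ⟨$⟩ʳ x)   ≡⟨ autX g g∈ v x ⟩
    Graph.adj Γ v x                    ≡⟨ vx ⟩
    true                               ∎

module Stabiliser {n : ℕ} (Γ : Graph n) (G H : PermGroup n)
         (autG : IsAutGroup Γ G) (regular : EdgeRegular Γ G) (p : Fin n) where
  open Local Γ p

  stabiliser-determined : ∀ {q g g'} → Adj Γ p q → Stab G g → Stab G g' →
    g ⟨$⟩ʳ q ≡ g' ⟨$⟩ʳ q → g ≗ₚ g'
  stabiliser-determined {q} {g} {g'} pq g∈@(g∈G , gp) (g'∈G , g'p) gq≡g'q =
    proj₂ (regular ((p , q) , pq) ((p , g ⟨$⟩ʳ q) , Stab-adj Γ p G autG g g∈ pq))
      g g' g∈G g'∈G (inj₁ (gp , refl)) (inj₁ (g'p , sym gq≡g'q))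

  sameLocal⇒fixes-neighbourhood : SameLocal G H → ∀ {q k x} → Adj Γ p q →
    Stab H k → k ⟨$⟩ʳ q ≡ q → Adj Γ p x → k ⟨$⟩ʳ x ≡ x
  sameLocal⇒fixes-neighbourhood (from-H , _) {q} {k} {x} pq k∈ kq px
    with from-H k k∈
  ... | g , g∈ , g≈k = trans (sym (g≈k x px)) (g≗id x)
    where
    g≗id : g ≗ₚ id
    g≗id = stabiliser-determined pq g∈ (PermGroup.id∈ G , refl) (trans (g≈k q pq) kq)

  completeColourPair⇒image-±1 : CompleteColourPair G H → ∀ {q k s s'} → Adj Γ p q →
    Stab H k → k ⟨$⟩ʳ q ≡ q → Stab G s → Stab G s' → k ⟨$⟩ʳ (s ⟨$⟩ʳ q) ≡ s' ⟨$⟩ʳ q →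
    s' ⟨$⟩ʳ q ≡ s ⟨$⟩ʳ q ⊎ s' ⟨$⟩ʳ q ≡ s ⁻¹ ⟨$⟩ʳ q
  completeColourPair⇒image-±1 (_ , _ , _ , _ , φ , φ∈ , _ , _ , φ-equivariant , φ-colour)
    {q} {k} {s} {s'} pq k∈ kq s∈ s'∈ ksq≡s'q =
    conclude (subst₂ (λ x y → (φ y · φ x ⁻¹ ≈ₗ Q · f ⁻¹) ⊎ (φ y · φ x ⁻¹ ≈ₗ f · Q ⁻¹))
                     kq ksq≡s'q
                     (φ-colour k q (s ⟨$⟩ʳ q) k∈ pq (Stab-adj Γ p G autG s s∈ pq)))
    where
    f Q Q' : Perm n
    f  = φ q
    Q  = φ (s ⟨$⟩ʳ q)
    Q' = φ (s' ⟨$⟩ʳ q)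

    pullback-adj : ∀ {z} → Adj Γ p z → Adj Γ p (f ⁻¹ ⟨$⟩ʳ z)
    pullback-adj = Stab-adj Γ p G autG (f ⁻¹) (Stab-⁻¹ Γ p G f (φ∈ q pq))

    -- The vertex x₀ of Γ(p) corresponds to the identity of G_p under φ.
    x₀ : Fin n
    x₀ = f ⁻¹ ⟨$⟩ʳ q

    φ-at : ∀ {g z} → Stab G g → Adj Γ p z → φ (g ⟨$⟩ʳ q) ⟨$⟩ʳ (f ⁻¹ ⟨$⟩ʳ z) ≡ g ⟨$⟩ʳ z
    φ-at {g} g∈ pz =
      trans (φ-equivariant g q g∈ pq _ (pullback-adj pz)) (cong (g ⟨$⟩ʳ_) (inverseʳ f))

    Q-sends-to-q : Q ⟨$⟩ʳ (f ⁻¹ ⟨$⟩ʳ (s ⁻¹ ⟨$⟩ʳ q)) ≡ q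
    Q-sends-to-q = trans (φ-at s∈ (Stab-adj Γ p G autG (s ⁻¹) (Stab-⁻¹ Γ p G s s∈) pq)) (inverseʳ s)

    conclude : (Q' · f ⁻¹ ≈ₗ Q · f ⁻¹) ⊎ (Q' · f ⁻¹ ≈ₗ f · Q ⁻¹) →
      s' ⟨$⟩ʳ q ≡ s ⟨$⟩ʳ q ⊎ s' ⟨$⟩ʳ q ≡ s ⁻¹ ⟨$⟩ʳ q
    conclude (inj₁ same) = inj₁ (begin
      s' ⟨$⟩ʳ q       ≡⟨ sym (φ-at s'∈ pq) ⟩
      Q' ⟨$⟩ʳ x₀      ≡⟨ ⟨$⟩ʳ-injective (f ⁻¹) (same x₀ (pullback-adj pq)) ⟩
      Q ⟨$⟩ʳ x₀       ≡⟨ φ-at s∈ pq ⟩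
      s ⟨$⟩ʳ q        ∎)
    conclude (inj₂ flipped) = inj₂ (⟨$⟩ʳ-injective (f ⁻¹) (begin
      f ⁻¹ ⟨$⟩ʳ (s' ⟨$⟩ʳ q)      ≡⟨ cong (f ⁻¹ ⟨$⟩ʳ_) (sym (φ-at s'∈ pq)) ⟩
      f ⁻¹ ⟨$⟩ʳ (Q' ⟨$⟩ʳ x₀)     ≡⟨ flipped x₀ (pullback-adj pq) ⟩
      Q ⁻¹ ⟨$⟩ʳ (f ⟨$⟩ʳ x₀)      ≡⟨ cong (Q ⁻¹ ⟨$⟩ʳ_) (inverseʳ f) ⟩
      Q ⁻¹ ⟨$⟩ʳ q                ≡⟨ Inverse.inverseʳ Q (sym Q-sends-to-q) ⟩
      f ⁻¹ ⟨$⟩ʳ (s ⁻¹ ⟨$⟩ʳ q)    ∎))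

  stabiliser-action-±1 : SameLocal G H ⊎ CompleteColourPair G H →
    ∀ {q k s s'} → Adj Γ p q → Stab H k → k ⟨$⟩ʳ q ≡ q → Stab G s → Stab G s' →
    k ⟨$⟩ʳ (s ⟨$⟩ʳ q) ≡ s' ⟨$⟩ʳ q → s' ≗ₚ s ⊎ s' ≗ₚ s ⁻¹
  stabiliser-action-±1 (inj₁ same) {q} {k} {s} pq k∈ kq s∈ s'∈ ksq≡s'q =
    inj₁ (stabiliser-determined pq s'∈ s∈ (trans (sym ksq≡s'q) k-fixes-sq))
    where
    k-fixes-sq : k ⟨$⟩ʳ (s ⟨$⟩ʳ q) ≡ s ⟨$⟩ʳ q
    k-fixes-sq = sameLocal⇒fixes-neighbourhood same pq k∈ kq (Stab-adj Γ p G autG s s∈ pq)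
  stabiliser-action-±1 (inj₂ pair) {s = s} pq k∈ kq s∈ s'∈ ksq≡s'q =
    Sum.map (stabiliser-determined pq s'∈ s∈)
            (stabiliser-determined pq s'∈ (Stab-⁻¹ Γ p G s s∈))
            (completeColourPair⇒image-±1 pair pq k∈ kq s∈ s'∈ ksq≡s'q)

module _ {n : ℕ} (Γ : Graph n) (G H : PermGroup n)
         (autG : IsAutGroup Γ G) (regular : EdgeRegular Γ G) (G≤H : G ≤G H)
         (local : ∀ v → Local.SameLocal Γ v G H ⊎ Local.CompleteColourPair Γ v G H) where
  open Stabiliser Γ G H autG regular using (stabiliser-action-±1)

  colour-preserved-at-shared-vertex : ∀ {p q a b a' b' h} → Adj Γ p q →
    G ∋ a → G ∋ b → G ∋ a' → G ∋ b' → H ∋ h → a ⟨$⟩ʳ p ≡ b ⟨$⟩ʳ p →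
    act a' (p , q) ≡ act (a · h) (p , q) → act b' (p , q) ≡ act (b · h) (p , q) →
    b' · a' ⁻¹ ≗ₚ b · a ⁻¹ ⊎ b' · a' ⁻¹ ≗ₚ (b · a ⁻¹) ⁻¹
  colour-preserved-at-shared-vertex {p} {q} {a} {b} {a'} {b'} {h} pq a∈ b∈ a'∈ b'∈ h∈ ap≡bp a'≡ah b'≡bh =
    stabiliser-action-±1 p (local p) {q} {k} {s} {s'} pq
      (H∋k , k-fixes (cong proj₁ a'≡ah)) (k-fixes (cong proj₂ a'≡ah))
      (·⁻¹∈ G b∈ a∈ , fixes-·⁻¹ a b (sym ap≡bp))
      (·⁻¹∈ G b'∈ a'∈ , fixes-·⁻¹ a' b' b'p≡a'p)
      k-sends-sq
    where
    s s' k : Perm n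
    s  = b · a ⁻¹
    s' = b' · a' ⁻¹
    k  = a · h · a' ⁻¹

    H∋k : H ∋ k
    H∋k = ·⁻¹∈ H (PermGroup.·∈ H (G≤H a a∈) h∈) (G≤H a' a'∈)

    k-fixes : ∀ {x} → a' ⟨$⟩ʳ x ≡ h ⟨$⟩ʳ (a ⟨$⟩ʳ x) → k ⟨$⟩ʳ x ≡ x
    k-fixes a'x≡hax = fixes-·⁻¹ a' (a · h) (sym a'x≡hax)

    b'p≡a'p : b' ⟨$⟩ʳ p ≡ a' ⟨$⟩ʳ p
    b'p≡a'p = begin
      b' ⟨$⟩ʳ p              ≡⟨ cong proj₁ b'≡bh ⟩
      h ⟨$⟩ʳ (b ⟨$⟩ʳ p)      ≡⟨ cong (h ⟨$⟩ʳ_) (sym ap≡bp) ⟩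
      h ⟨$⟩ʳ (a ⟨$⟩ʳ p)      ≡⟨ sym (cong proj₁ a'≡ah) ⟩
      a' ⟨$⟩ʳ p              ∎

    k-sends-sq : k ⟨$⟩ʳ (s ⟨$⟩ʳ q) ≡ s' ⟨$⟩ʳ q
    k-sends-sq = begin
      a' ⁻¹ ⟨$⟩ʳ (h ⟨$⟩ʳ (a ⟨$⟩ʳ (a ⁻¹ ⟨$⟩ʳ (b ⟨$⟩ʳ q))))  ≡⟨ cong (λ z → a' ⁻¹ ⟨$⟩ʳ (h ⟨$⟩ʳ z)) (inverseʳ a) ⟩
      a' ⁻¹ ⟨$⟩ʳ (h ⟨$⟩ʳ (b ⟨$⟩ʳ q))                       ≡⟨ cong (a' ⁻¹ ⟨$⟩ʳ_) (sym (cong proj₂ b'≡bh)) ⟩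
      a' ⁻¹ ⟨$⟩ʳ (b' ⟨$⟩ʳ q)                               ∎

proposition4p6 : ∀ (n : ℕ) (Γ : Graph n) (c : Fin n → Bool) (G H : PermGroup n) →
    Connected Γ → IsBipartition Γ c →
    IsAutGroup Γ G → IsAutGroup Γ H → EdgeRegular Γ G → G ≤G H →
    OrbitsAre H c →
    (∀ v → Local.SameLocal Γ v G H ⊎ Local.CompleteColourPair Γ v G H) →
    ∀ (e : Edge Γ) → ColourPreservingOnLineGraph Γ G H e
proposition4p6 n Γ c G H _ bipartite autG _ regular G≤H orbits local ((u , w) , uw)
  h a b a' b' h∈ a∈ b∈ a'∈ b'∈ ab-adj a'-image b'-image =
  subst₂ LAdj (sym a'≡ah) (sym b'≡bh) (act-preserves-LAdj h ab-adj) ,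
  colour (LAdj⇒shared-endpoint c cu≢cw a b (preserves a∈) (preserves b∈) ab-adj)
  where
  cu≢cw : ¬ c u ≡ c w
  cu≢cw = bipartite u w uw

  preserves : ∀ {g} → G ∋ g → PreservesColouring c g
  preserves g∈ = orbitsAre⇒preservesColouring c H orbits (G≤H _ g∈)

  follows-h : ∀ {g g'} → G ∋ g → G ∋ g' → act g' (u , w) ≈E act (g · h) (u , w) →
    act g' (u , w) ≡ act (g · h) (u , w)
  follows-h {g} {g'} g∈ g'∈ = ≈E⇒≡ c cu≢cw g' (g · h) (preserves g'∈)
    (orbitsAre⇒preservesColouring c H orbits (PermGroup.·∈ H (G≤H _ g∈) h∈))

  a'≡ah : act a' (u , w) ≡ act (a · h) (u , w)
  a'≡ah = follows-h a∈ a'∈ a'-image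

  b'≡bh : act b' (u , w) ≡ act (b · h) (u , w)
  b'≡bh = follows-h b∈ b'∈ b'-image

  -- (b · a ⁻¹) ⁻¹ and a · b ⁻¹ agree pointwise by computation.
  colour : a ⟨$⟩ʳ u ≡ b ⟨$⟩ʳ u ⊎ a ⟨$⟩ʳ w ≡ b ⟨$⟩ʳ w →
    (b' · a' ⁻¹ ≗ₚ b · a ⁻¹) ⊎ (b' · a' ⁻¹ ≗ₚ a · b ⁻¹)
  colour (inj₁ au≡bu) = colour-preserved-at-shared-vertex Γ G H autG regular G≤H local uw
    a∈ b∈ a'∈ b'∈ h∈ au≡bu a'≡ah b'≡bh
  colour (inj₂ aw≡bw) = colour-preserved-at-shared-vertex Γ G H autG regular G≤H local
    (trans (Graph.sym Γ w u) uw) a∈ b∈ a'∈ b'∈ h∈ aw≡bw (cong swap a'≡ah) (cong swap b'≡bh)
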